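{- (1) Let $T$ be a set of traces over $\mathcal{X}$. For every unconstrained hypertrace formula $\varphi$ over $\mathcal{X}$ and all assignments $\Pi_{\mathbb{T}},\Pi_{\mathbb{N}}$: $(T,(\Pi_{\mathbb{T}},\Pi_{\mathbb{N}}))\models\varphi$ iff $(\Pi_{\mathbb{N}},\mathtt{toSuppSet}(\Pi_{\mathbb{T}}))\models_{\mathrm{S1S}}\mathtt{toS1S}(\varphi,\mathcal{X})$. (2) For every $\mathrm{S1S}$ formula $\varphi$ and all first- and second-order assignments $\Pi_1,\Pi_2$ (and any set of traces $T$): $(\Pi_1,\Pi_2)\models_{\mathrm{S1S}}\varphi$ iff $(T,(\mathtt{toBool}(\Pi_2),\Pi_1))\models\mathtt{toHyper}(\varphi)$.
   Context: Hypertrace logic. Fix a finite set $\mathcal{X}$ of propositional variables; a trace is an infinite sequence of subsets of $\mathcal{X}$, $(2^{\mathcal{X}})^\omega$ the set of all traces, $\tau[k]$ its $k$-th element. Hypertrace formulas over trace variables and disjoint time variables: $\varphi ::= \exists\pi\,\varphi \mid \exists^{T}\pi\,\varphi \mid \exists i\,\varphi \mid \neg\varphi \mid \varphi\vee\varphi \mid i<j \mid i=j \mid x(\pi,i)$, $x\in\mathcal{X}$; usual abbreviations; each variable quantified at most once. For $T\subseteq(2^{\mathcal{X}})^\omega$, trace assignment $\Pi_{\mathbb{T}}$ and time assignment $\Pi_{\mathbb{N}}$: $\exists\pi$ ranges over all of $(2^{\mathcal{X}})^\omega$, $\exists^T\pi$ over $T$, $\exists i$ over $\mathbb{N}$; $i<j,i=j$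 as in $\mathbb{N}$; $x(\pi,i)$ holds iff $x\in\Pi_{\mathbb{T}}(\pi)[\Pi_{\mathbb{N}}(i)]$; this relation is written $(T,(\Pi_{\mathbb{T}},\Pi_{\mathbb{N}}))\models\varphi$. A formula is unconstrained if it contains no constrained quantifier $\exists^T$ (or $\forall^T$). S1S: formulas $\varphi ::= \exists X\,\varphi\mid\exists i\,\varphi\mid\neg\varphi\mid\varphi\vee\varphi\mid i=j\mid \mathrm{Succ}(i,j)\mid X(i)$ with first-order variables $i,j$ and second-order variables $X$, interpreted over $\mathbb{N}$ with a first-order assignment $\Pi_1$ into $\mathbb{N}$ and a second-order assignment $\Pi_2$ into subsets of $\mathbb{N}$; $\exists X$ ranges over subsets of $\mathbb{N}$, $\exists i$ over $\mathbb{N}$, $\mathrm{Succ}(i,j)$ iff $\Pi_1(j)=\Pi_1(i)+1$, $X(i)$ iff $\Pi_1(i)\in\Pi_2(X)$; $i<j$ is the S1S-definable strict order. $\mathtt{flatten}$: with $\mathcal{X}=\{x_0,\dots,x_n\}$ and fresh trace variables $\pi_x$: $\mathtt{flatten}(\exists\pi\,\varphi,\mathcal{X},\mathcal{V})=\exists\pi_{x_0}\cdots\exists\pi_{x_n}\mathtt{flatten}(\varphi,\mathcal{X},\mathcal{V}\cup\{\pi\})$; commutes with $\exists^T\pi$, $\exists i$, $\neg$, $\vee$; leaves $i<j,i=j$ unchanged; maps $x(\pi,i)$ to $x(\pi_x,i)$ if $\pi\in\mathcal{V}$, else unchanged. $\mathtt{toS1S}(\varphi,\mathcal{X})$ is obtained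 from $\mathtt{flatten}(\varphi,\mathcal{X},\mathcal{V}_{\mathbb{T}}\cap\mathrm{free}(\varphi))$ (where $\mathcal{V}_{\mathbb{T}}$ is the set of trace variables) by replacing every atom $x(\pi_x,i)$ with $\pi_x(i)$, reading each trace variable $\pi_x$ as a second-order variable (trace quantifiers become second-order quantifiers) and each time variable as a first-order variable. $\mathtt{toSuppSet}(\Pi_{\mathbb{T}})$ is the second-order assignment with $\mathtt{toSuppSet}(\Pi_{\mathbb{T}})(\pi_x)=\{i\mid x\in\Pi_{\mathbb{T}}(\pi)[i]\}$. $\mathtt{toHyper}$ maps S1S formulas to hypertrace formulas whose propositional variables include the second-order variables: $\mathtt{toHyper}(\exists X\,\varphi)=\exists\pi_X\,\mathtt{toHyper}(\varphi)$, $\mathtt{toHyper}(X(i))=X(\pi_X,i)$, commutes with $\exists i,\neg,\vee$, $\mathtt{toHyper}(i=j)=(i=j)$, $\mathtt{toHyper}(\mathrm{Succ}(i,i'))=i<i'\wedge\forall j\,(i<j\to i'\le j)$ (with $i'\le j$ meaning $i'<j\vee i'=j$). $\mathtt{toBool}(\Pi_2)$ is a trace assignment with $X\in\mathtt{toBool}(\Pi_2)(\pi_X)[i]$ iff $i\in\Pi_2(X)$, for all $i\in\mathbb{N}$ and second-order variables $X$. -}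

module Defs where

open import Data.Nat using (ℕ; zero; suc; _+_; _<_)
open import Data.Nat.Properties using () renaming (_≟_ to _≟ℕ_)
open import Data.Fin using (Fin; zero)
open import Data.Fin.Properties using () renaming (_≟_ to _≟F_)
open import Data.Bool using (Bool; true; false; if_then_else_)
open import Data.Sum using (_⊎_; inj₁; inj₂)
open import Data.Product using (Σ; _×_; _,_)
open import Data.Product.Properties using () renaming (≡-dec to ×-≡-dec)
open import Data.Maybe using (Maybe; just; nothing) renaming (map to mapM; zipWith to zipM)
open import Data.List using (List; []; _∷_; _++_; foldr; filter; allFin)
open import Data.List.Membership.DecPropositional _≟ℕ_ using (_∈?_)
open import Data.List.Relation.Unary.Unique.Propositional using (Unique)
open import Data.Empty using (⊥)
open import Data.Unit using (⊤)
open import Relation.Nullary using (¬_; does; ¬?)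
open import Relation.Binary.PropositionalEquality using (_≡_)
open import Relation.Binary.Definitions using (DecidableEquality)

-- Traces.  A trace over propositional variables P is an infinite
-- sequence of subsets of P; subsets are represented by characteristic
-- functions.  τ k x ≡ true  means  x ∈ τ[k].

Trace : Set → Set
Trace P = ℕ → P → Bool

upd : {A B : Set} → DecidableEquality A → (A → B) → A → B → A → B
upd _≟_ f a b a' = if does (a' ≟ a) then b else f a'

-- Hypertrace formulas: P = propositional variables, V = trace variables,
-- time variables are ℕ (a sort disjoint from V).

data HForm (P V : Set) : Set where
  ∃π   : V → HForm P V → HForm P V
  ∃ᵀπ  : V → HForm P V → HForm P V
  ∃i   : ℕ → HForm P V → HForm P V
  ¬ₕ   : HForm P V → HForm P V
  _∨ₕ_ : HForm P V → HForm P V → HForm P V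
  _<ₕ_ : ℕ → ℕ → HForm P V
  _=ₕ_ : ℕ → ℕ → HForm P V
  atom : P → V → ℕ → HForm P V

_∧ₕ_ : {P V : Set} → HForm P V → HForm P V → HForm P V
φ ∧ₕ ψ = ¬ₕ (¬ₕ φ ∨ₕ ¬ₕ ψ)

_→ₕ_ : {P V : Set} → HForm P V → HForm P V → HForm P V
φ →ₕ ψ = ¬ₕ φ ∨ₕ ψ

∀i : {P V : Set} → ℕ → HForm P V → HForm P V
∀i i φ = ¬ₕ (∃i i (¬ₕ φ))

_≤ₕ_ : {P V : Set} → ℕ → ℕ → HForm P V
i ≤ₕ j = (i <ₕ j) ∨ₕ (i =ₕ j)

sat : {P V : Set} → DecidableEquality V →
      (Trace P → Set) → (V → Trace P) → (ℕ → ℕ) → HForm P V → Set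
sat dV T Πₜ Πₙ (∃π π φ)  = Σ (Trace _) λ t → sat dV T (upd dV Πₜ π t) Πₙ φ
sat dV T Πₜ Πₙ (∃ᵀπ π φ) = Σ (Trace _) λ t → T t × sat dV T (upd dV Πₜ π t) Πₙ φ
sat dV T Πₜ Πₙ (∃i i φ)  = Σ ℕ λ k → sat dV T Πₜ (upd _≟ℕ_ Πₙ i k) φ
sat dV T Πₜ Πₙ (¬ₕ φ)    = ¬ sat dV T Πₜ Πₙ φ
sat dV T Πₜ Πₙ (φ ∨ₕ ψ)  = sat dV T Πₜ Πₙ φ ⊎ sat dV T Πₜ Πₙ ψ
sat dV T Πₜ Πₙ (i <ₕ j)  = Πₙ i < Πₙ j
sat dV T Πₜ Πₙ (i =ₕ j)  = Πₙ i ≡ Πₙ j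
sat dV T Πₜ Πₙ (atom x π i) = Πₜ π (Πₙ i) x ≡ true

Unconstrained : {P V : Set} → HForm P V → Set
Unconstrained (∃π _ φ)  = Unconstrained φ
Unconstrained (∃ᵀπ _ _) = ⊥
Unconstrained (∃i _ φ)  = Unconstrained φ
Unconstrained (¬ₕ φ)    = Unconstrained φ
Unconstrained (φ ∨ₕ ψ)  = Unconstrained φ × Unconstrained ψ
Unconstrained (_ <ₕ _)  = ⊤
Unconstrained (_ =ₕ _)  = ⊤
Unconstrained (atom _ _ _) = ⊤

boundT : {P V : Set} → HForm P V → List V
boundT (∃π π φ)  = π ∷ boundT φ
boundT (∃ᵀπ π φ) = π ∷ boundT φ
boundT (∃i _ φ)  = boundT φ
boundT (¬ₕ φ)    = boundT φ
boundT (φ ∨ₕ ψ)  = boundT φ ++ boundT ψ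
boundT _         = []

boundI : {P V : Set} → HForm P V → List ℕ
boundI (∃π _ φ)  = boundI φ
boundI (∃ᵀπ _ φ) = boundI φ
boundI (∃i i φ)  = i ∷ boundI φ
boundI (¬ₕ φ)    = boundI φ
boundI (φ ∨ₕ ψ)  = boundI φ ++ boundI ψ
boundI _         = []

WellFormed : {P V : Set} → HForm P V → Set
WellFormed φ = Unique (boundT φ) × Unique (boundI φ)

freeT : {P : Set} → HForm P ℕ → List ℕ
freeT (∃π π φ)  = filter (λ v → ¬? (v ≟ℕ π)) (freeT φ)
freeT (∃ᵀπ π φ) = filter (λ v → ¬? (v ≟ℕ π)) (freeT φ)
freeT (∃i _ φ)  = freeT φ
freeT (¬ₕ φ)    = freeT φ
freeT (φ ∨ₕ ψ)  = freeT φ ++ freeT ψ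
freeT (_ <ₕ _)  = []
freeT (_ =ₕ _)  = []
freeT (atom _ π _) = π ∷ []

-- flatten, for 𝒳 = {x₀,…,xₙ} = Fin (suc n), trace variables ℕ.
-- The fresh trace variable π_x is  inj₂ (π , x); an unflattened π is inj₁ π.

flatten : {n : ℕ} → HForm (Fin (suc n)) ℕ → List ℕ →
          HForm (Fin (suc n)) (ℕ ⊎ (ℕ × Fin (suc n)))
flatten {n} (∃π π φ) 𝒱 =
  foldr (λ x ψ → ∃π (inj₂ (π , x)) ψ) (flatten φ (π ∷ 𝒱)) (allFin (suc n))
flatten (∃ᵀπ π φ) 𝒱 = ∃ᵀπ (inj₁ π) (flatten φ 𝒱)
flatten (∃i i φ) 𝒱  = ∃i i (flatten φ 𝒱)
flatten (¬ₕ φ) 𝒱    = ¬ₕ (flatten φ 𝒱)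
flatten (φ ∨ₕ ψ) 𝒱  = flatten φ 𝒱 ∨ₕ flatten ψ 𝒱
flatten (i <ₕ j) 𝒱  = i <ₕ j
flatten (i =ₕ j) 𝒱  = i =ₕ j
flatten (atom x π i) 𝒱 =
  if does (π ∈? 𝒱) then atom x (inj₂ (π , x)) i else atom x (inj₁ π) i

data S1S (S : Set) : Set where
  ∃X     : S → S1S S → S1S S
  ∃ᵢ     : ℕ → S1S S → S1S S
  ¬ₛ     : S1S S → S1S S
  _∨ₛ_   : S1S S → S1S S → S1S S
  _=ₛ_   : ℕ → ℕ → S1S S
  Succ   : ℕ → ℕ → S1S S
  mem    : S → ℕ → S1S S

_∧ₛ_ : {S : Set} → S1S S → S1S S → S1S S
φ ∧ₛ ψ = ¬ₛ (¬ₛ φ ∨ₛ ¬ₛ ψ)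

_→ₛ_ : {S : Set} → S1S S → S1S S → S1S S
φ →ₛ ψ = ¬ₛ φ ∨ₛ ψ

∀X : {S : Set} → S → S1S S → S1S S
∀X X φ = ¬ₛ (∃X X (¬ₛ φ))

∀ᵢ : {S : Set} → ℕ → S1S S → S1S S
∀ᵢ i φ = ¬ₛ (∃ᵢ i (¬ₛ φ))

-- The S1S-definable strict order  i < j :
--   ¬(i = j) ∧ ∀X ((X(i) ∧ ∀k ∀k' (X(k) ∧ Succ(k,k') → X(k'))) → X(j))
-- with k = i+j+1, k' = i+j+2 (fresh w.r.t. i, j); the name of the bound
-- second-order variable X is irrelevant (no other SO variable occurs).
lt : {S : Set} → S → ℕ → ℕ → S1S S
lt X i j =
  ¬ₛ (i =ₛ j) ∧ₛ
  ∀X X ((mem X i ∧ₛ ∀ᵢ k (∀ᵢ k' ((mem X k ∧ₛ Succ k k') →ₛ mem X k')))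
        →ₛ mem X j)
  where k = suc (i + j)
        k' = suc k

satS : {S : Set} → DecidableEquality S →
       (ℕ → ℕ) → (S → ℕ → Bool) → S1S S → Set
satS dS Π₁ Π₂ (∃X X φ) = Σ (ℕ → Bool) λ A → satS dS Π₁ (upd dS Π₂ X A) φ
satS dS Π₁ Π₂ (∃ᵢ i φ) = Σ ℕ λ k → satS dS (upd _≟ℕ_ Π₁ i k) Π₂ φ
satS dS Π₁ Π₂ (¬ₛ φ)   = ¬ satS dS Π₁ Π₂ φ
satS dS Π₁ Π₂ (φ ∨ₛ ψ) = satS dS Π₁ Π₂ φ ⊎ satS dS Π₁ Π₂ ψ
satS dS Π₁ Π₂ (i =ₛ j) = Π₁ i ≡ Π₁ j
satS dS Π₁ Π₂ (Succ i j) = Π₁ j ≡ suc (Π₁ i)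
satS dS Π₁ Π₂ (mem X i) = Π₂ X (Π₁ i) ≡ true

-- Partial (Maybe): formulas that are not of the
-- required shape (∃^T, unflattened trace variables, atoms x(π_y,i) with
-- x ≠ y) have no reading.

readS1S : {n : ℕ} → HForm (Fin (suc n)) (ℕ ⊎ (ℕ × Fin (suc n))) →
          Maybe (S1S (ℕ × Fin (suc n)))
readS1S (∃π (inj₂ v) φ) = mapM (∃X v) (readS1S φ)
readS1S (∃π (inj₁ _) _) = nothing
readS1S (∃ᵀπ _ _)       = nothing
readS1S (∃i i φ)        = mapM (∃ᵢ i) (readS1S φ)
readS1S (¬ₕ φ)          = mapM ¬ₛ (readS1S φ)
readS1S (φ ∨ₕ ψ)        = zipM _∨ₛ_ (readS1S φ) (readS1S ψ)
readS1S (i <ₕ j)        = just (lt (0 , zero) i j)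
readS1S (i =ₕ j)        = just (i =ₛ j)
readS1S (atom x (inj₁ _) i) = nothing
readS1S (atom x (inj₂ (π , y)) i) =
  if does (x ≟F y) then just (mem (π , y) i) else nothing

toS1S : {n : ℕ} → HForm (Fin (suc n)) ℕ → Maybe (S1S (ℕ × Fin (suc n)))
toS1S φ = readS1S (flatten φ (freeT φ))

toSuppSet : {n : ℕ} → (ℕ → Trace (Fin (suc n))) → (ℕ × Fin (suc n)) → ℕ → Bool
toSuppSet Πₜ (π , x) i = Πₜ π i x

≟SO : {n : ℕ} → DecidableEquality (ℕ × Fin (suc n))
≟SO = ×-≡-dec _≟ℕ_ _≟F_

-- toHyper : S1S formulas (second-order variables ℕ) to hypertrace formulas
-- whose propositional variables and trace variables are the second-order
-- variables (π_X is X itself).  In the Succ clause the bound time variable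
-- j is chosen as i+i'+1, fresh w.r.t. i and i'.

toHyper : S1S ℕ → HForm ℕ ℕ
toHyper (∃X X φ)   = ∃π X (toHyper φ)
toHyper (∃ᵢ i φ)   = ∃i i (toHyper φ)
toHyper (¬ₛ φ)     = ¬ₕ (toHyper φ)
toHyper (φ ∨ₛ ψ)   = toHyper φ ∨ₕ toHyper ψ
toHyper (i =ₛ j)   = i =ₕ j
toHyper (Succ i i') = (i <ₕ i') ∧ₕ ∀i j ((i <ₕ j) →ₕ (i' ≤ₕ j))
  where j = suc (i + i')
toHyper (mem X i)  = atom X X i

IsToBool : (ℕ → ℕ → Bool) → (ℕ → Trace ℕ) → Set
IsToBool Π₂ Πₜ = ∀ X i → Πₜ X i X ≡ Π₂ X i

{-# OPTIONS --safe #-}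
-- Both translations are compositional, so each direction is an induction on formulas that
-- carries a correspondence between assignments: a trace π corresponds to the support sets
-- π_x of its propositions, and a trace quantifier ∃π to the block of set quantifiers ∃π_x,
-- x ∈ 𝒳.  Only the order atoms are not translated literally.  The S1S formula for i < j is
-- correct because a ≤ b iff every successor-closed set containing a contains b, and the
-- hypertrace formula for Succ(i, i') because b = a + 1 iff b is the least number above a.
-- All atomic facts are decidable, so the double negations by which the formulas encode
-- ∧, → and ∀ can be discharged.
module Submission where

open import Defs
open import Data.Nat using (ℕ; suc; _+_; _<_; _≤_; _≤ᵇ_; _<?_; z≤n)
open import Data.Nat.Properties
  using (_≟_; ≤ᵇ⇒≤; ≤⇒≤ᵇ; ≤-refl; ≤-reflexive; ≤-antisym; <⇒≤; <⇒≢; ≤∧≢⇒<; n<1+n;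
         m≤n⇒m≤1+n; m≤n⇒m<n∨m≡n; m<1+n⇒m≤n; 1+n≢n; m≢1+m+n; m≢1+n+m)
open import Data.Bool using (Bool; true)
open import Data.Bool.Properties using (T-≡) renaming (_≟_ to _≟B_)
open import Data.Fin using (Fin; zero)
open import Data.Fin.Properties using () renaming (_≟_ to _≟F_)
open import Data.List using (List; []; _∷_; foldr; allFin)
open import Data.List.Relation.Unary.Any using (here; there)
open import Data.List.Membership.Propositional using (_∈_)
open import Data.List.Membership.Propositional.Properties using (∈-allFin; ∈-filter⁺; ∈-++⁺ˡ; ∈-++⁺ʳ)
import Data.List.Membership.DecPropositional as DecMembership
open import Data.Maybe using (just) renaming (map to mapM)
open import Data.Product using (Σ; ∃; _×_; _,_; map₂; curry; uncurry)
open import Data.Product.Properties using (,-injectiveˡ; ,-injectiveʳ)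
open import Data.Product.Function.NonDependent.Propositional using (_×-⇔_)
open import Data.Sum using (_⊎_; inj₁; inj₂; [_,_])
open import Data.Sum.Function.Propositional using (_⊎-⇔_)
open import Level using (0ℓ)
open import Function using (_∘_; id)
open import Function.Bundles using (_⇔_; mk⇔; Equivalence)
open import Function.Construct.Composition using (_⇔-∘_)
open import Function.Construct.Identity using (⇔-id)
open import Function.Properties.Equivalence using (⇔-setoid)
open import Function.Construct.Symmetry using (⇔-sym)
open import Function.Related.TypeIsomorphisms using (¬-cong-⇔; →-cong-⇔)
open import Relation.Nullary using (¬_; ¬?; yes; no)
open import Relation.Nullary.Negation using (Stable; negated-stable; contradiction)
open import Relation.Nullary.Decidable using (decidable-stable; dec-true; _⊎-dec_)
open import Relation.Binary.PropositionalEquality using (_≡_; _≢_; refl; sym; trans; cong; cong-app; subst)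
open import Relation.Binary.Definitions using (DecidableEquality)
open import Relation.Binary.Reasoning.Setoid (⇔-setoid 0ℓ)

open Equivalence

upd-updates : {A B : Set} (d : DecidableEquality A) (f : A → B) (a : A) (b : B) → upd d f a b a ≡ b
upd-updates d f a b with d a a
... | yes _   = refl
... | no a≢a = contradiction refl a≢a

upd-minimal : {A B : Set} (d : DecidableEquality A) (f : A → B) {a a' : A} (b : B) →
              a' ≢ a → upd d f a b a' ≡ f a'
upd-minimal d f {a} {a'} b a'≢a with d a' a
... | yes a'≡a = contradiction a'≡a a'≢a
... | no _     = refl

∃-cong-⇔ : {A : Set} {P Q : A → Set} → (∀ x → P x ⇔ Q x) → ∃ P ⇔ ∃ Q
∃-cong-⇔ P⇔Q = mk⇔ (map₂ λ {x} → to (P⇔Q x)) (map₂ λ {x} → from (P⇔Q x))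

∀-cong-⇔ : {A : Set} {P Q : A → Set} → (∀ x → P x ⇔ Q x) → (∀ x → P x) ⇔ (∀ x → Q x)
∀-cong-⇔ P⇔Q = mk⇔ (λ p x → to (P⇔Q x) (p x)) (λ q x → from (P⇔Q x) (q x))

¬[¬⊎¬]⇔× : {A B : Set} → Stable A → Stable B → (¬ (¬ A ⊎ ¬ B)) ⇔ (A × B)
¬[¬⊎¬]⇔× stable-A stable-B = mk⇔
  (λ h → stable-A (h ∘ inj₁) , stable-B (h ∘ inj₂))
  (λ (a , b) → [ (λ ¬a → ¬a a) , (λ ¬b → ¬b b) ])

¬∃¬⇔∀ : {A : Set} {P : A → Set} → (∀ x → Stable (P x)) → (¬ ∃ λ x → ¬ P x) ⇔ (∀ x → P x)
¬∃¬⇔∀ stable = mk⇔ (λ h x → stable x (λ ¬p → h (x , ¬p))) (λ h (x , ¬p) → ¬p (h x))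

¬∃¬[¬⊎]⇔∀→ : {A : Set} {P Q : A → Set} → (∀ x → Stable (Q x)) →
             (¬ ∃ λ x → ¬ (¬ P x ⊎ Q x)) ⇔ (∀ x → P x → Q x)
¬∃¬[¬⊎]⇔∀→ stable = mk⇔
  (λ h x p → stable x (λ ¬q → h (x , [ (λ ¬p → ¬p p) , ¬q ])))
  (λ h (x , ¬d) → ¬d (inj₁ (λ p → ¬d (inj₂ (h x p)))))

≡true-stable : {b : Bool} → Stable (b ≡ true)
≡true-stable {b} = decidable-stable (b ≟B true)

SuccClosed : (ℕ → Bool) → Set
SuccClosed A = ∀ m → A m ≡ true → A (suc m) ≡ true

Reaches : ℕ → ℕ → Set
Reaches a b = ∀ A → A a ≡ true → SuccClosed A → A b ≡ true

≤⇒Reaches : ∀ {a b} → a ≤ b → Reaches a b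
≤⇒Reaches {b = 0} z≤n A Aa _ = Aa
≤⇒Reaches {b = suc b} a≤1+b A Aa closed with m≤n⇒m<n∨m≡n a≤1+b
... | inj₁ a<1+b = closed b (≤⇒Reaches (m<1+n⇒m≤n a<1+b) A Aa closed)
... | inj₂ refl  = Aa

Reaches⇒≤ : ∀ {a b} → Reaches a b → a ≤ b
Reaches⇒≤ {a} {b} reaches =
  ≤ᵇ⇒≤ a b (from T-≡ (reaches (a ≤ᵇ_) (to T-≡ (≤⇒≤ᵇ (≤-refl {a}))) closed))
  where
  closed : SuccClosed (a ≤ᵇ_)
  closed m a≤m = to T-≡ (≤⇒≤ᵇ (m≤n⇒m≤1+n (≤ᵇ⇒≤ a m (from T-≡ a≤m))))

<⇔≢×Reaches : ∀ {a b} → a < b ⇔ (a ≢ b × Reaches a b)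
<⇔≢×Reaches = mk⇔
  (λ a<b → <⇒≢ a<b , ≤⇒Reaches (<⇒≤ a<b))
  (λ (a≢b , reaches) → ≤∧≢⇒< (Reaches⇒≤ reaches) a≢b)

≡suc⇔least-above : ∀ {a b} → b ≡ suc a ⇔ (a < b × ∀ c → a < c → b ≤ c)
≡suc⇔least-above {a} = mk⇔
  (λ { refl → n<1+n a , λ _ a<c → a<c })
  (λ (a<b , least) → ≤-antisym (least (suc a) (n<1+n a)) a<b)

_[_↦_] : (ℕ → ℕ) → ℕ → ℕ → ℕ → ℕ
Π [ i ↦ k ] = upd _≟_ Π i k

succClosedₛ : {S : Set} → S → ℕ → ℕ → S1S S
succClosedₛ X k k' = ∀ᵢ k (∀ᵢ k' ((mem X k ∧ₛ Succ k k') →ₛ mem X k'))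

inductionₛ : {S : Set} → S → ℕ → ℕ → ℕ → ℕ → S1S S
inductionₛ X i j k k' = ∀X X ((mem X i ∧ₛ succClosedₛ X k k') →ₛ mem X j)

module _ {S : Set} (dS : DecidableEquality S) (X : S) where

  satS-SuccClosed : ∀ {k k'} → k ≢ k' → (Π₁ : ℕ → ℕ) (Π₂ : S → ℕ → Bool) →
    satS dS Π₁ Π₂ (succClosedₛ X k k') ⇔ SuccClosed (Π₂ X)
  satS-SuccClosed {k} {k'} k≢k' Π₁ Π₂ = begin
    satS dS Π₁ Π₂ (succClosedₛ X k k')
      ≈⟨ ¬∃¬⇔∀ (λ _ → negated-stable) ⟩
    (∀ m → satS dS (Π₁ [ k ↦ m ]) Π₂ (∀ᵢ k' ((mem X k ∧ₛ Succ k k') →ₛ mem X k')))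
      ≈⟨ ∀-cong-⇔ (λ _ → ¬∃¬[¬⊎]⇔∀→ (λ _ → ≡true-stable)) ⟩
    (∀ m m' → let Π = Π₁ [ k ↦ m ] [ k' ↦ m' ] in
              satS dS Π Π₂ (mem X k ∧ₛ Succ k k') → satS dS Π Π₂ (mem X k'))
      ≈⟨ ∀-cong-⇔ (λ m → ∀-cong-⇔ (step m)) ⟩
    (∀ m m' → Π₂ X m ≡ true × m' ≡ suc m → Π₂ X m' ≡ true)
      ≈⟨ mk⇔ (λ h m Xm → h m (suc m) (Xm , refl)) (λ { closed m _ (Xm , refl) → closed m Xm }) ⟩
    SuccClosed (Π₂ X) ∎
    where
    step : ∀ m m' → let Π = upd _≟_ (upd _≟_ Π₁ k m) k' m' in
           (satS dS Π Π₂ (mem X k ∧ₛ Succ k k') → Π₂ X (Π k') ≡ true)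
           ⇔ (Π₂ X m ≡ true × m' ≡ suc m → Π₂ X m' ≡ true)
    step m m' rewrite upd-updates _≟_ (upd _≟_ Π₁ k m) k' m'
                    | upd-minimal _≟_ (upd _≟_ Π₁ k m) m' k≢k'
                    | upd-updates _≟_ Π₁ k m
      = →-cong-⇔ (¬[¬⊎¬]⇔× ≡true-stable (decidable-stable (m' ≟ suc m))) (⇔-id _)

  satS-inductionₛ : ∀ {i j k k'} → k ≢ k' → (Π₁ : ℕ → ℕ) (Π₂ : S → ℕ → Bool) →
    satS dS Π₁ Π₂ (inductionₛ X i j k k') ⇔ Reaches (Π₁ i) (Π₁ j)
  satS-inductionₛ {i} {j} {k} {k'} k≢k' Π₁ Π₂ = begin
    satS dS Π₁ Π₂ (inductionₛ X i j k k')
      ≈⟨ ¬∃¬[¬⊎]⇔∀→ (λ _ → ≡true-stable) ⟩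
    (∀ A → let Π = upd dS Π₂ X A in
           satS dS Π₁ Π (mem X i ∧ₛ succClosedₛ X k k') → satS dS Π₁ Π (mem X j))
      ≈⟨ ∀-cong-⇔ (λ A → →-cong-⇔ ((⇔-id _ ×-⇔ satS-SuccClosed k≢k' Π₁ (upd dS Π₂ X A))
                                     ⇔-∘ ¬[¬⊎¬]⇔× ≡true-stable negated-stable) (⇔-id _)) ⟩
    (∀ A → let F = upd dS Π₂ X A X in F (Π₁ i) ≡ true × SuccClosed F → F (Π₁ j) ≡ true)
      ≈⟨ ∀-cong-⇔ updated-set ⟩
    Reaches (Π₁ i) (Π₁ j) ∎
    where
    updated-set : ∀ A → let F = upd dS Π₂ X A X in
                  (F (Π₁ i) ≡ true × SuccClosed F → F (Π₁ j) ≡ true)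
                  ⇔ (A (Π₁ i) ≡ true → SuccClosed A → A (Π₁ j) ≡ true)
    updated-set A rewrite upd-updates dS Π₂ X A = mk⇔ curry uncurry

  satS-lt : (Π₁ : ℕ → ℕ) (Π₂ : S → ℕ → Bool) (i j : ℕ) → satS dS Π₁ Π₂ (lt X i j) ⇔ (Π₁ i < Π₁ j)
  satS-lt Π₁ Π₂ i j = begin
    satS dS Π₁ Π₂ (lt X i j)
      ≈⟨ ¬[¬⊎¬]⇔× negated-stable negated-stable ⟩
    (Π₁ i ≢ Π₁ j × satS dS Π₁ Π₂ (inductionₛ X i j (suc (i + j)) (suc (suc (i + j)))))
      ≈⟨ ⇔-id _ ×-⇔ satS-inductionₛ (1+n≢n {suc (i + j)} ∘ sym) Π₁ Π₂ ⟩
    (Π₁ i ≢ Π₁ j × Reaches (Π₁ i) (Π₁ j))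
      ≈⟨ <⇔≢×Reaches ⟨
    Π₁ i < Π₁ j ∎

sat-toHyper-Succ : (T : Trace ℕ → Set) (Πₜ : ℕ → Trace ℕ) (Π₁ : ℕ → ℕ) (i i' : ℕ) →
                   sat _≟_ T Πₜ Π₁ (toHyper (Succ i i')) ⇔ (Π₁ i' ≡ suc (Π₁ i))
sat-toHyper-Succ T Πₜ Π₁ i i' = begin
  sat _≟_ T Πₜ Π₁ (toHyper (Succ i i'))
    ≈⟨ ¬[¬⊎¬]⇔× (decidable-stable (Π₁ i <? Π₁ i')) negated-stable ⟩
  (Π₁ i < Π₁ i' × sat _≟_ T Πₜ Π₁ (∀i j ((i <ₕ j) →ₕ (i' ≤ₕ j))))
    ≈⟨ ⇔-id _ ×-⇔ ¬∃¬[¬⊎]⇔∀→ (λ _ → decidable-stable (_ <? _ ⊎-dec _ ≟ _)) ⟩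
  (Π₁ i < Π₁ i' × ∀ c → let Π = Π₁ [ j ↦ c ] in Π i < Π j → Π i' < Π j ⊎ Π i' ≡ Π j)
    ≈⟨ ⇔-id _ ×-⇔ ∀-cong-⇔ step ⟩
  (Π₁ i < Π₁ i' × ∀ c → Π₁ i < c → Π₁ i' ≤ c)
    ≈⟨ ≡suc⇔least-above ⟨
  Π₁ i' ≡ suc (Π₁ i) ∎
  where
  j = suc (i + i')
  step : ∀ c → let Π = upd _≟_ Π₁ j c in
         (Π i < Π j → Π i' < Π j ⊎ Π i' ≡ Π j) ⇔ (Π₁ i < c → Π₁ i' ≤ c)
  step c = evaluated (upd-minimal _≟_ Π₁ c (m≢1+m+n i)) (upd-minimal _≟_ Π₁ c (m≢1+n+m i'))
                     (upd-updates _≟_ Π₁ j c)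
    where
    evaluated : ∀ {a b c a' b' c'} → a' ≡ a → b' ≡ b → c' ≡ c →
                (a' < c' → b' < c' ⊎ b' ≡ c') ⇔ (a < c → b ≤ c)
    evaluated refl refl refl = →-cong-⇔ (⇔-id _) (mk⇔ [ <⇒≤ , ≤-reflexive ] m≤n⇒m<n∨m≡n)

IsToBool-upd : ∀ {Π₂ Πₜ} X A (t : Trace ℕ) → IsToBool Π₂ Πₜ → (∀ i → t i X ≡ A i) →
               IsToBool (upd _≟_ Π₂ X A) (upd _≟_ Πₜ X t)
IsToBool-upd {Π₂} {Πₜ} X A t rep t-X Y i with Y ≟ X
... | yes refl = trans (cong (λ τ → τ i Y) (upd-updates _≟_ Πₜ Y t))
                       (trans (t-X i) (sym (cong-app (upd-updates _≟_ Π₂ Y A) i)))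
... | no Y≢X  = trans (cong (λ τ → τ i Y) (upd-minimal _≟_ Πₜ t Y≢X))
                       (trans (rep Y i) (sym (cong-app (upd-minimal _≟_ Π₂ A Y≢X) i)))

toHyper-faithful : (φ : S1S ℕ) (Π₁ : ℕ → ℕ) (Π₂ : ℕ → ℕ → Bool) (T : Trace ℕ → Set)
                   (Πₜ : ℕ → Trace ℕ) → IsToBool Π₂ Πₜ →
                   satS _≟_ Π₁ Π₂ φ ⇔ sat _≟_ T Πₜ Π₁ (toHyper φ)
toHyper-faithful (∃X X φ) Π₁ Π₂ T Πₜ rep = mk⇔
  (λ (A , s) → (λ i _ → A i) , to (faithful-upd X A (λ i _ → A i) λ _ → refl) s)
  (λ (t , s) → (λ i → t i X) , from (faithful-upd X (λ i → t i X) t λ _ → refl) s)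
  where
  faithful-upd : ∀ X A t → (∀ i → t i X ≡ A i) →
                 satS _≟_ Π₁ (upd _≟_ Π₂ X A) φ ⇔ sat _≟_ T (upd _≟_ Πₜ X t) Π₁ (toHyper φ)
  faithful-upd X A t t-X = toHyper-faithful φ Π₁ _ T _ (IsToBool-upd X A t rep t-X)
toHyper-faithful (∃ᵢ i φ) Π₁ Π₂ T Πₜ rep =
  ∃-cong-⇔ λ k → toHyper-faithful φ (Π₁ [ i ↦ k ]) Π₂ T Πₜ rep
toHyper-faithful (¬ₛ φ) Π₁ Π₂ T Πₜ rep = ¬-cong-⇔ (toHyper-faithful φ Π₁ Π₂ T Πₜ rep)
toHyper-faithful (φ ∨ₛ ψ) Π₁ Π₂ T Πₜ rep =
  toHyper-faithful φ Π₁ Π₂ T Πₜ rep ⊎-⇔ toHyper-faithful ψ Π₁ Π₂ T Πₜ rep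
toHyper-faithful (i =ₛ j) Π₁ Π₂ T Πₜ rep = ⇔-id _
toHyper-faithful (Succ i i') Π₁ Π₂ T Πₜ rep = ⇔-sym (sat-toHyper-Succ T Πₜ Π₁ i i')
toHyper-faithful (mem X i) Π₁ Π₂ T Πₜ rep =
  mk⇔ (trans (rep X (Π₁ i))) (trans (sym (rep X (Π₁ i))))

_≗₂_ : {A B C : Set} → (A → B → C) → (A → B → C) → Set
f ≗₂ g = ∀ a b → f a b ≡ g a b

module _ {n : ℕ} (π : ℕ) where

  open DecMembership (_≟F_ {suc n}) using (_∈?_)

  ∃Xs : List (Fin (suc n)) → S1S (ℕ × Fin (suc n)) → S1S (ℕ × Fin (suc n))
  ∃Xs xs ψ = foldr (λ x → ∃X (π , x)) ψ xs

  readS1S-∃πs : ∀ {body ψ} xs → readS1S body ≡ just ψ →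
                readS1S (foldr (λ x → ∃π (inj₂ (π , x))) body xs) ≡ just (∃Xs xs ψ)
  readS1S-∃πs []       read = read
  readS1S-∃πs (x ∷ xs) read = cong (mapM (∃X (π , x))) (readS1S-∃πs xs read)

  updAll : (Fin (suc n) → ℕ → Bool) → (ℕ × Fin (suc n) → ℕ → Bool) → List (Fin (suc n)) →
           ℕ × Fin (suc n) → ℕ → Bool
  updAll g Π₂ []       = Π₂
  updAll g Π₂ (x ∷ xs) = updAll g (upd ≟SO Π₂ (π , x) (g x)) xs

  updAll-minimal : ∀ {g Π₂ v} xs → (∀ {x} → x ∈ xs → v ≢ (π , x)) → updAll g Π₂ xs v ≡ Π₂ v
  updAll-minimal []       _    = refl
  updAll-minimal {g} {Π₂} (x ∷ xs) v∉xs =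
    trans (updAll-minimal {g} xs (v∉xs ∘ there)) (upd-minimal ≟SO Π₂ (g x) (v∉xs (here refl)))

  updAll-updates : ∀ {g Π₂ x} xs → x ∈ xs → updAll g Π₂ xs (π , x) ≡ g x
  updAll-updates (_ ∷ xs) (there x∈xs) = updAll-updates xs x∈xs
  updAll-updates {g} {Π₂} {x} (_ ∷ xs) (here refl) with x ∈? xs
  ... | yes x∈xs = updAll-updates xs x∈xs
  ... | no x∉xs  =
    trans (updAll-minimal {g} xs (λ x'∈xs eq → x∉xs (subst (_∈ xs) (sym (,-injectiveʳ eq)) x'∈xs)))
          (upd-updates ≟SO Π₂ (π , x) (g x))

  satS-∃Xs-intro : ∀ {Π₁ Π₂ ψ} g xs → satS ≟SO Π₁ (updAll g Π₂ xs) ψ → satS ≟SO Π₁ Π₂ (∃Xs xs ψ)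
  satS-∃Xs-intro g []       s = s
  satS-∃Xs-intro g (x ∷ xs) s = g x , satS-∃Xs-intro g xs s

  AgreeOff : (ℕ × Fin (suc n) → ℕ → Bool) → (ℕ × Fin (suc n) → ℕ → Bool) → Set
  AgreeOff Π₂ Π₂' = ∀ {π'} → π' ≢ π → ∀ x → Π₂ (π' , x) ≡ Π₂' (π' , x)

  satS-∃Xs-elim : ∀ {Π₁ Π₂ ψ} xs → satS ≟SO Π₁ Π₂ (∃Xs xs ψ) →
                  Σ _ λ Π₂' → AgreeOff Π₂' Π₂ × satS ≟SO Π₁ Π₂' ψ
  satS-∃Xs-elim []       s       = _ , (λ _ _ → refl) , s
  satS-∃Xs-elim {Π₂ = Π₂} (x ∷ xs) (A , s) with satS-∃Xs-elim xs s
  ... | Π₂' , agree , s' =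
    Π₂' , (λ π'≢π y → trans (agree π'≢π y) (upd-minimal ≟SO Π₂ A (π'≢π ∘ ,-injectiveˡ))) , s'

  ≗₂-toSuppSet-upd : ∀ {Πₜ Π₂ Π₂'} {t : Trace (Fin (suc n))} →
                     Π₂ ≗₂ toSuppSet Πₜ → AgreeOff Π₂' Π₂ → (∀ x i → Π₂' (π , x) i ≡ t i x) →
                     Π₂' ≗₂ toSuppSet (upd _≟_ Πₜ π t)
  ≗₂-toSuppSet-upd {Πₜ} {t = t} rep agree on-π (π' , x) i with π' ≟ π
  ... | yes refl = trans (on-π x i) (sym (cong (λ τ → τ i x) (upd-updates _≟_ Πₜ π t)))
  ... | no π'≢π  = trans (cong-app (agree π'≢π x) i)
                         (trans (rep (π' , x) i)
                                (sym (cong (λ τ → τ i x) (upd-minimal _≟_ Πₜ t π'≢π))))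

module _ {n : ℕ} (T : Trace (Fin (suc n)) → Set) where

  -- Generalised from toSuppSet Πₜ to anything pointwise equal to it, since the assignments
  -- produced by a block ∃Xs agree with toSuppSet of the updated trace assignment only pointwise.
  FaithfulReading : HForm (Fin (suc n)) ℕ → List ℕ → Set
  FaithfulReading φ 𝒱 = Σ (S1S (ℕ × Fin (suc n))) λ ψ → readS1S (flatten φ 𝒱) ≡ just ψ ×
    (∀ Πₜ Πₙ Π₂ → Π₂ ≗₂ toSuppSet Πₜ → sat _≟_ T Πₜ Πₙ φ ⇔ satS ≟SO Πₙ Π₂ ψ)

  atom-faithful : ∀ x π i 𝒱 → π ∈ 𝒱 → FaithfulReading (atom x π i) 𝒱
  atom-faithful x π i 𝒱 π∈𝒱 rewrite dec-true (DecMembership._∈?_ _≟_ π 𝒱) π∈𝒱 =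
    mem (π , x) i , read ,
    λ Πₜ Πₙ Π₂ rep → mk⇔ (trans (rep (π , x) (Πₙ i))) (trans (sym (rep (π , x) (Πₙ i))))
    where
    read : readS1S (atom x (inj₂ (π , x)) i) ≡ just (mem (π , x) i)
    read rewrite dec-true (x ≟F x) refl = refl

  ∃π-faithful : ∀ π φ 𝒱 → FaithfulReading φ (π ∷ 𝒱) → FaithfulReading (∃π π φ) 𝒱
  ∃π-faithful π φ 𝒱 (ψ , read , faithful) =
    ∃Xs π (allFin _) ψ , readS1S-∃πs π (allFin _) read ,
    λ _ _ _ rep → mk⇔ (intro rep) (elim rep)
    where
    intro : ∀ {Πₜ Πₙ Π₂} → Π₂ ≗₂ toSuppSet Πₜ →
            sat _≟_ T Πₜ Πₙ (∃π π φ) → satS ≟SO Πₙ Π₂ (∃Xs π (allFin _) ψ)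
    intro {Πₜ} {Πₙ} {Π₂} rep (t , s) = satS-∃Xs-intro π g (allFin _) (to (faithful _ Πₙ _ rep') s)
      where
      g : Fin (suc n) → ℕ → Bool
      g x i = t i x
      rep' : updAll π g Π₂ (allFin _) ≗₂ toSuppSet (upd _≟_ Πₜ π t)
      rep' = ≗₂-toSuppSet-upd π rep
               (λ π'≢π _ → updAll-minimal π {g} (allFin _) (λ _ → π'≢π ∘ ,-injectiveˡ))
               (λ x → cong-app (updAll-updates π {g} (allFin _) (∈-allFin x)))
    elim : ∀ {Πₜ Πₙ Π₂} → Π₂ ≗₂ toSuppSet Πₜ →
           satS ≟SO Πₙ Π₂ (∃Xs π (allFin _) ψ) → sat _≟_ T Πₜ Πₙ (∃π π φ)
    elim {Πₙ = Πₙ} rep s with satS-∃Xs-elim π (allFin _) s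
    ... | Π₂' , agree , s' =
      (λ i x → Π₂' (π , x) i) ,
      from (faithful _ Πₙ Π₂' (≗₂-toSuppSet-upd π rep agree λ _ _ → refl)) s'

  flatten-faithful : ∀ φ 𝒱 → Unconstrained φ → (∀ {π} → π ∈ freeT φ → π ∈ 𝒱) → FaithfulReading φ 𝒱
  flatten-faithful (∃π π φ) 𝒱 u free⊆𝒱 = ∃π-faithful π φ 𝒱 (flatten-faithful φ (π ∷ 𝒱) u free⊆π∷𝒱)
    where
    free⊆π∷𝒱 : ∀ {π'} → π' ∈ freeT φ → π' ∈ π ∷ 𝒱
    free⊆π∷𝒱 {π'} π'∈φ with π' ≟ π
    ... | yes π'≡π = here π'≡π
    ... | no π'≢π  = there (free⊆𝒱 (∈-filter⁺ (λ v → ¬? (v ≟ π)) π'∈φ π'≢π))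
  flatten-faithful (∃i i φ) 𝒱 u free⊆𝒱 with flatten-faithful φ 𝒱 u free⊆𝒱
  ... | ψ , read , faithful =
    ∃ᵢ i ψ , cong (mapM (∃ᵢ i)) read ,
    λ Πₜ Πₙ Π₂ rep → ∃-cong-⇔ λ k → faithful Πₜ (Πₙ [ i ↦ k ]) Π₂ rep
  flatten-faithful (¬ₕ φ) 𝒱 u free⊆𝒱 with flatten-faithful φ 𝒱 u free⊆𝒱
  ... | ψ , read , faithful =
    ¬ₛ ψ , cong (mapM ¬ₛ) read , λ Πₜ Πₙ Π₂ rep → ¬-cong-⇔ (faithful Πₜ Πₙ Π₂ rep)
  flatten-faithful (φ₁ ∨ₕ φ₂) 𝒱 (u₁ , u₂) free⊆𝒱
    with flatten-faithful φ₁ 𝒱 u₁ (λ π∈ → free⊆𝒱 (∈-++⁺ˡ π∈))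
       | flatten-faithful φ₂ 𝒱 u₂ (λ π∈ → free⊆𝒱 (∈-++⁺ʳ (freeT φ₁) π∈))
  ... | ψ₁ , read₁ , faithful₁ | ψ₂ , read₂ , faithful₂ =
    ψ₁ ∨ₛ ψ₂ , read , λ Πₜ Πₙ Π₂ rep → faithful₁ Πₜ Πₙ Π₂ rep ⊎-⇔ faithful₂ Πₜ Πₙ Π₂ rep
    where
    read : readS1S (flatten φ₁ 𝒱 ∨ₕ flatten φ₂ 𝒱) ≡ just (ψ₁ ∨ₛ ψ₂)
    read rewrite read₁ | read₂ = refl
  flatten-faithful (i <ₕ j) 𝒱 _ _ =
    lt (0 , zero) i j , refl , λ Πₜ Πₙ Π₂ _ → ⇔-sym (satS-lt ≟SO (0 , zero) Πₙ Π₂ i j)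
  flatten-faithful (i =ₕ j) 𝒱 _ _ = (i =ₛ j) , refl , λ _ _ _ _ → ⇔-id _
  flatten-faithful (atom x π i) 𝒱 _ free⊆𝒱 = atom-faithful x π i 𝒱 (free⊆𝒱 (here refl))

  toS1S-faithful : ∀ φ → Unconstrained φ →
                   Σ (S1S (ℕ × Fin (suc n))) λ ψ → toS1S φ ≡ just ψ ×
                     (∀ Πₜ Πₙ → sat _≟_ T Πₜ Πₙ φ ⇔ satS ≟SO Πₙ (toSuppSet Πₜ) ψ)
  toS1S-faithful φ u with flatten-faithful φ (freeT φ) u id
  ... | ψ , read , faithful = ψ , read , λ Πₜ Πₙ → faithful Πₜ Πₙ (toSuppSet Πₜ) λ _ _ → refl

theorem3 :
    -- (1) unconstrained hypertrace formulas to S1S, over 𝒳 = {x₀,…,xₙ}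
    (∀ {n : ℕ} (T : Trace (Fin (suc n)) → Set) (φ : HForm (Fin (suc n)) ℕ) →
       WellFormed φ → Unconstrained φ →
       Σ (S1S (ℕ × Fin (suc n))) λ ψ → (toS1S φ ≡ just ψ) ×
         ((Πₜ : ℕ → Trace (Fin (suc n))) (Πₙ : ℕ → ℕ) →
            sat _≟_ T Πₜ Πₙ φ ⇔ satS ≟SO Πₙ (toSuppSet Πₜ) ψ))
    ×
    -- (2) S1S formulas to hypertrace formulas
    ((φ : S1S ℕ) (Π₁ : ℕ → ℕ) (Π₂ : ℕ → ℕ → Bool) (T : Trace ℕ → Set)
       (Πₜ : ℕ → Trace ℕ) → IsToBool Π₂ Πₜ →
       satS _≟_ Π₁ Π₂ φ ⇔ sat _≟_ T Πₜ Π₁ (toHyper φ))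
theorem3 = (λ T φ _ → toS1S-faithful T φ) , toHyper-faithful
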